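{- Let $q$ be an odd prime power with $q\equiv 1\pmod 3$, let $m=(q-1)/3$, and let $\gamma$ be a generator of the multiplicative group $\mathbf{F}_q^*$. For $k\in\{0,1,\dots,m-1\}$ define $a,b,c,d,e,f\in\mathbf{F}_q^*$ by $$a=\frac{2\gamma^{3k+1}}{3},\quad b=\frac{\gamma^{2m}}{3},\quad c=\frac{ -\gamma^{2m+3k+1}}{3},\quad d=\frac{\gamma^{m}}{3},\quad e=\frac{ -\gamma^{m+3k+1}}{3},\quad f=\frac{1}{3}.$$ Then the polynomial $$g(x)=ax^{3m-1}+bx^{2m+1}+cx^{2m-1}+dx^{m+1}+ex^{m-1}+fx$$ is a permutation polynomial over $\mathbf{F}_q$, and the permutation of $\mathbf{F}_q$ it induces is an involution with exactly $m+1$ fixed points.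
   Context: $\mathbf{F}_q$ denotes the finite field with $q$ elements. A permutation polynomial over $\mathbf{F}_q$ is a polynomial $g\in\mathbf{F}_q[x]$ whose associated map $\mathbf{F}_q\to\mathbf{F}_q$, $x\mapsto g(x)$, is a bijection; it is involutory if $g(g(x))=x$ for all $x\in\mathbf{F}_q$. -}

module Defs where

open import Level using (0ℓ)
open import Data.Nat as ℕ using (ℕ; zero; suc)
open import Relation.Nullary using (¬_)
open import Relation.Binary.PropositionalEquality using (_≡_)
open import Algebra.Structures using (IsCommutativeRing)

-- A field whose equality is propositional equality on the carrier F.
-- The inverse is a total function; it is only constrained on nonzero elements.
record IsField (F : Set) : Set where
  infixl 6 _+_
  infixl 7 _*_
  field
    _+_ _*_ : F → F → F
    -_      : F → F
    0# 1#   : F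
    _⁻¹     : F → F
    isCommutativeRing : IsCommutativeRing _≡_ _+_ _*_ -_ 0# 1#
    0≢1     : ¬ (0# ≡ 1#)
    inverseʳ : ∀ x → ¬ (x ≡ 0#) → x * (x ⁻¹) ≡ 1#

  infixr 8 _^_
  _^_ : F → ℕ → F
  x ^ zero  = 1#
  x ^ suc n = x * (x ^ n)

  three : F
  three = 1# + 1# + 1#

  _/3 : F → F
  y /3 = y * (three ⁻¹)

module _ {F : Set} (𝔽 : IsField F) where
  open IsField 𝔽

  gPoly : (m k : ℕ) (γ : F) → F → F
  gPoly m k γ x =
      a * x ^ (3 ℕ.* m ℕ.∸ 1) + b * x ^ (2 ℕ.* m ℕ.+ 1) + c * x ^ (2 ℕ.* m ℕ.∸ 1)
    + d * x ^ (m ℕ.+ 1) + e * x ^ (m ℕ.∸ 1) + f * x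
    where
      a = ((1# + 1#) * γ ^ (3 ℕ.* k ℕ.+ 1)) /3
      b = (γ ^ (2 ℕ.* m)) /3
      c = (- (γ ^ (2 ℕ.* m ℕ.+ 3 ℕ.* k ℕ.+ 1))) /3
      d = (γ ^ m) /3
      e = (- (γ ^ (m ℕ.+ 3 ℕ.* k ℕ.+ 1))) /3
      f = 1# /3

module Submission where

-- On F* put u(x) = γ^m x^m and β = γ^(3k+1). Since x^(3m) = 1, u(x) is a cube root of unity, and
-- reducing the exponents of g modulo 3m gives g(x) = (x (1 + u + u²) + (β/x) (2 - u - u²)) / 3.
-- So g(x) = x when u(x) = 1, and g(x) = β/x when 1 + u + u² = 0; also g(0) = 0.
-- The map x ↦ β/x keeps u ≠ 1, because u(x) u(β/x) = γ^(2m) β^m = γ^(3m) = 1; hence g is an involution.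
-- A fixed point with u(x) ≠ 1 would have x² = β, so u(x)² = 1 = u(x)³, forcing u(x) = 1. The fixed points
-- are therefore 0 and the γ^t (t < 3m) with γ^((t+1)m) = 1, i.e. 3 ∣ t + 1: these are m + 1 elements.
-- That γ has order exactly q - 1 = 3m is obtained by counting through the bijection Fin q ↔ F, and
-- 3 ≠ 0 in F because γ^m is a cube root of unity different from 1.

open import Defs

open import Algebra.Bundles using (CommutativeRing)
open import Algebra.Solver.Ring.AlmostCommutativeRing using (fromCommutativeRing; _-Raw-AlmostCommutative⟶_)
open import Axiom.UniquenessOfIdentityProofs using (module Decidable⇒UIP)
open import Data.Empty using (⊥-elim)
open import Data.Fin as Fin using (Fin; toℕ; fromℕ<; punchOut)
import Data.Fin.Properties as Fin
open import Data.Integer as ℤ using (ℤ; +_; -[1+_]; _⊖_; _◃_; sign; ∣_∣)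
import Data.Integer.Properties as ℤ
import Data.Maybe as Maybe
open import Data.Nat as ℕ using (ℕ; zero; suc)
open import Data.Nat.DivMod using (m≡m%n+[m/n]*n; m%n<n; m*n/n≡m)
open import Data.Nat.Divisibility using (_∣_; divides; m%n≡0⇒n∣m; *-cancelʳ-∣)
import Data.Nat.Properties as ℕ
open import Data.Nat.Tactic.RingSolver using (solve-∀)
open import Data.Sign as Sign using (Sign)
open import Data.Sum using (inj₁; inj₂)
open import Function.Bundles using (_↔_; Inverse; Injection; Bijection; mk↔ₛ′)
open import Function.Definitions using (Bijective)
open import Function.Properties.Inverse using (↔⇒↣; ↔⇒⤖; ↔-sym)
open import Level using (0ℓ)
open import Relation.Binary.Consequences using (dec⇒weaklyDec)
open import Relation.Binary.Definitions using (DecidableEquality)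
open import Relation.Binary.PropositionalEquality as ≡ using (_≡_; cong)
open import Relation.Nullary using (yes; no)

module IntegerCoefficients {c ℓ} (R : CommutativeRing c ℓ) where

  open CommutativeRing R
  open import Algebra.Properties.Ring ring using (-0#≈0#; -‿involutive; -1*x≈-x)
  open import Algebra.Properties.AbelianGroup +-abelianGroup using (⁻¹-∙-comm)
  open import Algebra.Properties.Semiring.Mult.TCOptimised semiring using (_×_; ×1-homo-*; ×-homo-+; 1+×)
  open import Algebra.Properties.CommutativeSemigroup +-commutativeSemigroup using (interchange)
  open import Algebra.Properties.CommutativeSemigroup *-commutativeSemigroup
    using () renaming (interchange to *-interchange)
  open import Relation.Binary.Reasoning.Setoid setoid

  fromℤ : ℤ → Carrier
  fromℤ (+ n)      = n × 1#
  fromℤ -[1+ n ]   = - (suc n × 1#)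

  fromℤ-⊖ : ∀ m n → fromℤ (m ⊖ n) ≈ m × 1# + - (n × 1#)
  fromℤ-⊖ m       zero    = trans (sym (+-identityʳ _)) (+-congˡ (sym -0#≈0#))
  fromℤ-⊖ zero    (suc n) = sym (+-identityˡ _)
  fromℤ-⊖ (suc m) (suc n) = begin
    fromℤ (suc m ⊖ suc n)               ≡⟨ cong fromℤ (ℤ.[1+m]⊖[1+n]≡m⊖n m n) ⟩
    fromℤ (m ⊖ n)                       ≈⟨ fromℤ-⊖ m n ⟩
    m × 1# + - (n × 1#)                 ≈⟨ +-identityˡ _ ⟨
    0# + (m × 1# + - (n × 1#))          ≈⟨ +-congʳ (-‿inverseʳ 1#) ⟨
    (1# + - 1#) + (m × 1# + - (n × 1#)) ≈⟨ interchange _ _ _ _ ⟩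
    (1# + m × 1#) + (- 1# + - (n × 1#)) ≈⟨ +-cong (sym (1+× m 1#)) (⁻¹-∙-comm 1# (n × 1#)) ⟩
    suc m × 1# + - (1# + n × 1#)        ≈⟨ +-congˡ (-‿cong (1+× n 1#)) ⟨
    suc m × 1# + - (suc n × 1#)         ∎

  +-homo : ∀ i j → fromℤ (i ℤ.+ j) ≈ fromℤ i + fromℤ j
  +-homo (+ m)    (+ n)    = ×-homo-+ 1# m n
  +-homo (+ m)    -[1+ n ] = fromℤ-⊖ m (suc n)
  +-homo -[1+ m ] (+ n)    = trans (fromℤ-⊖ n (suc m)) (+-comm _ _)
  +-homo -[1+ m ] -[1+ n ] = begin
    - (suc (suc (m ℕ.+ n)) × 1#)    ≡⟨ cong (λ z → - (suc z × 1#)) (ℕ.+-suc m n) ⟨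
    - ((suc m ℕ.+ suc n) × 1#)      ≈⟨ -‿cong (×-homo-+ 1# (suc m) (suc n)) ⟩
    - (suc m × 1# + suc n × 1#)     ≈⟨ ⁻¹-∙-comm _ _ ⟨
    - (suc m × 1#) + - (suc n × 1#) ∎

  fromSign : Sign → Carrier
  fromSign Sign.+ = 1#
  fromSign Sign.- = - 1#

  sign-homo : ∀ s t → fromSign (s Sign.* t) ≈ fromSign s * fromSign t
  sign-homo Sign.+ t      = sym (*-identityˡ _)
  sign-homo Sign.- Sign.+ = sym (-1*x≈-x 1#)
  sign-homo Sign.- Sign.- = trans (sym (-‿involutive 1#)) (sym (-1*x≈-x (- 1#)))

  fromℤ-◃ : ∀ s n → fromℤ (s ◃ n) ≈ fromSign s * (n × 1#)
  fromℤ-◃ s      zero    = sym (zeroʳ _)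
  fromℤ-◃ Sign.+ (suc n) = sym (*-identityˡ _)
  fromℤ-◃ Sign.- (suc n) = sym (-1*x≈-x _)

  fromℤ-sign◃abs : ∀ i → fromℤ i ≈ fromSign (sign i) * (∣ i ∣ × 1#)
  fromℤ-sign◃abs i = trans (reflexive (cong fromℤ (≡.sym (ℤ.◃-inverse i)))) (fromℤ-◃ (sign i) ∣ i ∣)

  *-homo : ∀ i j → fromℤ (i ℤ.* j) ≈ fromℤ i * fromℤ j
  *-homo i j = begin
    fromℤ (i ℤ.* j)
      ≈⟨ fromℤ-◃ (sign i Sign.* sign j) (∣ i ∣ ℕ.* ∣ j ∣) ⟩
    fromSign (sign i Sign.* sign j) * ((∣ i ∣ ℕ.* ∣ j ∣) × 1#)
      ≈⟨ *-cong (sign-homo (sign i) (sign j)) (×1-homo-* ∣ i ∣ ∣ j ∣) ⟩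
    (fromSign (sign i) * fromSign (sign j)) * ((∣ i ∣ × 1#) * (∣ j ∣ × 1#))
      ≈⟨ *-interchange _ _ _ _ ⟩
    (fromSign (sign i) * (∣ i ∣ × 1#)) * (fromSign (sign j) * (∣ j ∣ × 1#))
      ≈⟨ *-cong (fromℤ-sign◃abs i) (fromℤ-sign◃abs j) ⟨
    fromℤ i * fromℤ j
      ∎

  -‿homo : ∀ i → fromℤ (ℤ.- i) ≈ - fromℤ i
  -‿homo (+ zero)  = sym -0#≈0#
  -‿homo (+ suc n) = refl
  -‿homo -[1+ n ]  = sym (-‿involutive _)

  homomorphism : ℤ.+-*-rawRing -Raw-AlmostCommutative⟶ fromCommutativeRing R
  homomorphism = record
    { ⟦_⟧ = fromℤ ; +-homo = +-homo ; *-homo = *-homo ; -‿homo = -‿homo ; 0-homo = refl ; 1-homo = refl }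

  open import Algebra.Solver.Ring ℤ.+-*-rawRing (fromCommutativeRing R) homomorphism
    (λ i j → Maybe.map (λ i≡j → reflexive (cong fromℤ i≡j)) (dec⇒weaklyDec ℤ._≟_ i j)) public

-- Opened only now: IntegerCoefficients uses the setoid's refl/sym/trans and the ring's _×_.
open ≡ using (_≢_; refl; sym; trans; cong₂; subst; module ≡-Reasoning)
open import Data.Product using (Σ; ∃; _,_; proj₁; proj₂; _×_)

exponent-form : ∀ {m t} → t ℕ.< 3 ℕ.* m → 3 ∣ suc t → ∃ λ (j : Fin m) → t ≡ 3 ℕ.* toℕ j ℕ.+ 2
exponent-form _ (divides zero ())
exponent-form {m} {t} t<3m (divides (suc j) 1+t≡[1+j]*3) =
  fromℕ< j<m , trans t≡3j+2 (cong (λ i → 3 ℕ.* i ℕ.+ 2) (sym (Fin.toℕ-fromℕ< j<m)))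
  where
    t≡3j+2 : t ≡ 3 ℕ.* j ℕ.+ 2
    t≡3j+2 = trans (ℕ.suc-injective 1+t≡[1+j]*3) (trans (ℕ.+-comm 2 (j ℕ.* 3)) (cong (ℕ._+ 2) (ℕ.*-comm j 3)))
    j<m : j ℕ.< m
    j<m = ℕ.*-cancelˡ-< 3 j m (ℕ.≤-<-trans (ℕ.m≤m+n (3 ℕ.* j) 2) (subst (ℕ._< 3 ℕ.* m) t≡3j+2 t<3m))

3i+2-injective : ∀ {i j} → 3 ℕ.* i ℕ.+ 2 ≡ 3 ℕ.* j ℕ.+ 2 → i ≡ j
3i+2-injective {i} {j} eq = ℕ.*-cancelˡ-≡ i j 3 (ℕ.+-cancelʳ-≡ 2 (3 ℕ.* i) (3 ℕ.* j) eq)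

j<m⇒3j+2<3m : ∀ {j m} → j ℕ.< m → 3 ℕ.* j ℕ.+ 2 ℕ.< 3 ℕ.* m
j<m⇒3j+2<3m {j} {m} j<m = subst (ℕ._≤ 3 ℕ.* m) (3[1+j]≡1+[3j+2] j) (ℕ.*-monoʳ-≤ 3 j<m)
  where
    3[1+j]≡1+[3j+2] : ∀ j → 3 ℕ.* suc j ≡ suc (3 ℕ.* j ℕ.+ 2)
    3[1+j]≡1+[3j+2] = solve-∀

[1+[3j+2]]*m≡3m*[1+j] : ∀ j m → suc (3 ℕ.* j ℕ.+ 2) ℕ.* m ≡ 3 ℕ.* m ℕ.* suc j
[1+[3j+2]]*m≡3m*[1+j] = solve-∀

[3k+1]*m≡3m*k+m : ∀ k m → (3 ℕ.* k ℕ.+ 1) ℕ.* m ≡ 3 ℕ.* m ℕ.* k ℕ.+ m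
[3k+1]*m≡3m*k+m = solve-∀

q≡1+3[[q-1]/3] : ∀ q → q ℕ.% 3 ≡ 1 → q ≡ suc (3 ℕ.* ((q ℕ.∸ 1) ℕ./ 3))
q≡1+3[[q-1]/3] q q%3≡1 = trans q≡1+[q/3]*3 (cong suc (trans (ℕ.*-comm (q ℕ./ 3) 3) (cong (3 ℕ.*_) (sym [q-1]/3≡q/3))))
  where
    q≡1+[q/3]*3 : q ≡ suc (q ℕ./ 3 ℕ.* 3)
    q≡1+[q/3]*3 = trans (m≡m%n+[m/n]*n q 3) (cong (ℕ._+ q ℕ./ 3 ℕ.* 3) q%3≡1)
    [q-1]/3≡q/3 : (q ℕ.∸ 1) ℕ./ 3 ≡ q ℕ./ 3
    [q-1]/3≡q/3 = trans (cong (λ z → (z ℕ.∸ 1) ℕ./ 3) q≡1+[q/3]*3) (m*n/n≡m (q ℕ./ 3) 3)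

module FieldProperties {F : Set} (𝔽 : IsField F) where

  open IsField 𝔽

  commutativeRing : CommutativeRing 0ℓ 0ℓ
  commutativeRing = record { isCommutativeRing = isCommutativeRing }

  open CommutativeRing commutativeRing public
    using (*-assoc; *-comm; *-identityˡ; *-identityʳ; zeroˡ; zeroʳ; +-identityˡ; -‿inverseʳ)
  open IntegerCoefficients commutativeRing public using (solve; _:=_; _:+_; _:*_; :-_; con; Polynomial)
  open CommutativeRing commutativeRing using (semiring; commutativeSemiring)
  import Algebra.Properties.Semiring.Exp semiring as Exp
  import Algebra.Properties.CommutativeSemiring.Exp commutativeSemiring as CommExp
  open Exp using () renaming (_^_ to _^ᴿ_)
  open ≡-Reasoning

  𝟘 𝟙 : ∀ {n} → Polynomial n
  𝟘 = con (+ 0)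
  𝟙 = con (+ 1)

  ^≡^ᴿ : ∀ x n → x ^ n ≡ x ^ᴿ n
  ^≡^ᴿ x zero    = refl
  ^≡^ᴿ x (suc n) = cong (x *_) (^≡^ᴿ x n)

  ^-homo-* : ∀ x i j → x ^ (i ℕ.+ j) ≡ x ^ i * x ^ j
  ^-homo-* x i j rewrite ^≡^ᴿ x (i ℕ.+ j) | ^≡^ᴿ x i | ^≡^ᴿ x j = Exp.^-homo-* x i j

  ^-assocʳ : ∀ x i j → (x ^ i) ^ j ≡ x ^ (i ℕ.* j)
  ^-assocʳ x i j rewrite ^≡^ᴿ x (i ℕ.* j) | ^≡^ᴿ (x ^ i) j | ^≡^ᴿ x i = Exp.^-assocʳ x i j

  ^-distrib-* : ∀ x y n → (x * y) ^ n ≡ x ^ n * y ^ n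
  ^-distrib-* x y n rewrite ^≡^ᴿ (x * y) n | ^≡^ᴿ x n | ^≡^ᴿ y n = CommExp.^-distrib-* x y n

  x^[2m]≡x^m² : ∀ x m → x ^ (2 ℕ.* m) ≡ x ^ m * x ^ m
  x^[2m]≡x^m² x m = trans (cong (λ e → x ^ (m ℕ.+ e)) (ℕ.+-identityʳ m)) (^-homo-* x m m)

  x^[3m]≡x^m³ : ∀ x m → x ^ (3 ℕ.* m) ≡ x ^ m * (x ^ m * x ^ m)
  x^[3m]≡x^m³ x m = trans (^-homo-* x m (2 ℕ.* m)) (cong (x ^ m *_) (x^[2m]≡x^m² x m))

  1^n≡1 : ∀ n → 1# ^ n ≡ 1#
  1^n≡1 zero    = refl
  1^n≡1 (suc n) = trans (cong (1# *_) (1^n≡1 n)) (*-identityˡ 1#)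

  x^d≡1⇒x^[d*t]≡1 : ∀ {x d} → x ^ d ≡ 1# → ∀ t → x ^ (d ℕ.* t) ≡ 1#
  x^d≡1⇒x^[d*t]≡1 {x} {d} xᵈ≡1 t = trans (sym (^-assocʳ x d t)) (trans (cong (_^ t) xᵈ≡1) (1^n≡1 t))

  ^-% : ∀ {x d} .{{_ : ℕ.NonZero d}} → x ^ d ≡ 1# → ∀ t → x ^ (t ℕ.% d) ≡ x ^ t
  ^-% {x} {d} xᵈ≡1 t = sym (begin
    x ^ t                                   ≡⟨ cong (x ^_) (m≡m%n+[m/n]*n t d) ⟩
    x ^ (t ℕ.% d ℕ.+ t ℕ./ d ℕ.* d)         ≡⟨ ^-homo-* x (t ℕ.% d) _ ⟩
    x ^ (t ℕ.% d) * x ^ (t ℕ./ d ℕ.* d)     ≡⟨ cong (λ e → x ^ (t ℕ.% d) * x ^ e) (ℕ.*-comm (t ℕ./ d) d) ⟩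
    x ^ (t ℕ.% d) * x ^ (d ℕ.* (t ℕ./ d))   ≡⟨ cong (x ^ (t ℕ.% d) *_) (x^d≡1⇒x^[d*t]≡1 {x} {d} xᵈ≡1 (t ℕ./ d)) ⟩
    x ^ (t ℕ.% d) * 1#                      ≡⟨ *-identityʳ _ ⟩
    x ^ (t ℕ.% d)                           ∎)

  x⁻¹*x≡1 : ∀ {x} → x ≢ 0# → x ⁻¹ * x ≡ 1#
  x⁻¹*x≡1 {x} x≢0 = trans (*-comm _ _) (inverseʳ x x≢0)

  *-cancelˡ : ∀ {x y z} → x ≢ 0# → x * y ≡ x * z → y ≡ z
  *-cancelˡ {x} {y} {z} x≢0 xy≡xz = begin
    y                ≡⟨ *-identityˡ y ⟨
    1# * y           ≡⟨ cong (_* y) (x⁻¹*x≡1 x≢0) ⟨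
    (x ⁻¹ * x) * y   ≡⟨ *-assoc _ _ _ ⟩
    x ⁻¹ * (x * y)   ≡⟨ cong (x ⁻¹ *_) xy≡xz ⟩
    x ⁻¹ * (x * z)   ≡⟨ *-assoc _ _ _ ⟨
    (x ⁻¹ * x) * z   ≡⟨ cong (_* z) (x⁻¹*x≡1 x≢0) ⟩
    1# * z           ≡⟨ *-identityˡ z ⟩
    z                ∎

  x*y≡0⇒y≡0 : ∀ {x y} → x ≢ 0# → x * y ≡ 0# → y ≡ 0#
  x*y≡0⇒y≡0 {x} x≢0 xy≡0 = *-cancelˡ x≢0 (trans xy≡0 (sym (zeroʳ x)))

  *-≢0 : ∀ {x y} → x ≢ 0# → y ≢ 0# → x * y ≢ 0#
  *-≢0 x≢0 y≢0 xy≡0 = y≢0 (x*y≡0⇒y≡0 x≢0 xy≡0)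

  x*y⁻¹*y≡x : ∀ {x y} → y ≢ 0# → x * y ⁻¹ * y ≡ x
  x*y⁻¹*y≡x {x} {y} y≢0 = trans (*-assoc x _ y) (trans (cong (x *_) (x⁻¹*x≡1 y≢0)) (*-identityʳ x))

  ^-≢0 : ∀ {x} → x ≢ 0# → ∀ n → x ^ n ≢ 0#
  ^-≢0 x≢0 zero    = λ 1≡0 → 0≢1 (sym 1≡0)
  ^-≢0 x≢0 (suc n) = *-≢0 x≢0 (^-≢0 x≢0 n)

  ⁻¹-≢0 : ∀ {x} → x ≢ 0# → x ⁻¹ ≢ 0#
  ⁻¹-≢0 {x} x≢0 x⁻¹≡0 = 0≢1 (begin
    0#         ≡⟨ zeroˡ x ⟨
    0# * x     ≡⟨ cong (_* x) x⁻¹≡0 ⟨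
    x ⁻¹ * x   ≡⟨ x⁻¹*x≡1 x≢0 ⟩
    1#         ∎)

  ^-∸ : ∀ {x i j} → x ≢ 0# → i ℕ.≤ j → x ^ i ≡ x ^ j → x ^ (j ℕ.∸ i) ≡ 1#
  ^-∸ {x} {i} {j} x≢0 i≤j xⁱ≡xʲ = sym (*-cancelˡ (^-≢0 x≢0 i) (begin
    x ^ i * 1#                ≡⟨ *-identityʳ _ ⟩
    x ^ i                     ≡⟨ xⁱ≡xʲ ⟩
    x ^ j                     ≡⟨ cong (x ^_) (ℕ.m∸n+n≡m i≤j) ⟨
    x ^ (j ℕ.∸ i ℕ.+ i)       ≡⟨ ^-homo-* x (j ℕ.∸ i) i ⟩
    x ^ (j ℕ.∸ i) * x ^ i     ≡⟨ *-comm _ _ ⟩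
    x ^ i * x ^ (j ℕ.∸ i)     ∎))

  x-1≡0⇒x≡1 : ∀ {x} → x + - 1# ≡ 0# → x ≡ 1#
  x-1≡0⇒x≡1 {x} x-1≡0 = begin
    x                ≡⟨ solve 1 (λ x → x := (x :+ :- 𝟙) :+ 𝟙) refl x ⟩
    (x + - 1#) + 1#  ≡⟨ cong (_+ 1#) x-1≡0 ⟩
    0# + 1#          ≡⟨ +-identityˡ 1# ⟩
    1#               ∎

  x≢1⇒x-1≢0 : ∀ {x} → x ≢ 1# → x + - 1# ≢ 0#
  x≢1⇒x-1≢0 x≢1 x-1≡0 = x≢1 (x-1≡0⇒x≡1 x-1≡0)

  x³≡1∧x≢1⇒1+x+x²≡0 : ∀ {x} → x * (x * x) ≡ 1# → x ≢ 1# → 1# + x + x * x ≡ 0#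
  x³≡1∧x≢1⇒1+x+x²≡0 {x} x³≡1 x≢1 = x*y≡0⇒y≡0 (x≢1⇒x-1≢0 x≢1) (begin
    (x + - 1#) * (1# + x + x * x) ≡⟨ solve 1 (λ x → (x :+ :- 𝟙) :* (𝟙 :+ x :+ x :* x) := x :* (x :* x) :+ :- 𝟙) refl x ⟩
    x * (x * x) + - 1#            ≡⟨ cong (_+ - 1#) x³≡1 ⟩
    1# + - 1#                     ≡⟨ -‿inverseʳ 1# ⟩
    0#                            ∎)

  1+x+x²≡0∧x≢1⇒three≢0 : ∀ {x} → 1# + x + x * x ≡ 0# → x ≢ 1# → three ≢ 0#
  1+x+x²≡0∧x≢1⇒three≢0 {x} 1+x+x²≡0 x≢1 three≡0 = x-1≢0 (x*y≡0⇒y≡0 x-1≢0 (begin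
    (x + - 1#) * (x + - 1#)              ≡⟨ solve 1 (λ x → (x :+ :- 𝟙) :* (x :+ :- 𝟙)
                                                := (𝟙 :+ x :+ x :* x) :+ :- ((𝟙 :+ 𝟙 :+ 𝟙) :* x)) refl x ⟩
    (1# + x + x * x) + - (three * x)     ≡⟨ cong₂ (λ s t → s + - (t * x)) 1+x+x²≡0 three≡0 ⟩
    0# + - (0# * x)                      ≡⟨ solve 1 (λ x → 𝟘 :+ :- (𝟘 :* x) := 𝟘) refl x ⟩
    0#                                   ∎))
    where x-1≢0 = x≢1⇒x-1≢0 x≢1

  x^j≡x⁻¹*x^[1+j] : ∀ {x} → x ≢ 0# → ∀ j → x ^ j ≡ x ⁻¹ * x ^ suc j
  x^j≡x⁻¹*x^[1+j] {x} x≢0 j = *-cancelˡ x≢0 (begin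
    x * x ^ j                ≡⟨ *-identityˡ _ ⟨
    1# * (x * x ^ j)         ≡⟨ cong (_* (x * x ^ j)) (inverseʳ x x≢0) ⟨
    (x * x ⁻¹) * (x * x ^ j) ≡⟨ *-assoc _ _ _ ⟩
    x * (x ⁻¹ * x ^ suc j)   ∎)

  interpolate : F → F → F → F
  interpolate x y v = three ⁻¹ * (x * (1# + v + v * v) + y * ((1# + 1#) + - v + - (v * v)))

  interpolate-1 : three ≢ 0# → ∀ x y → interpolate x y 1# ≡ x
  interpolate-1 three≢0 x y = begin
    interpolate x y 1#   ≡⟨ solve 3 (λ T x y →
                               T :* (x :* (𝟙 :+ 𝟙 :+ 𝟙 :* 𝟙) :+ y :* ((𝟙 :+ 𝟙) :+ :- 𝟙 :+ :- (𝟙 :* 𝟙)))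
                               := x :* ((𝟙 :+ 𝟙 :+ 𝟙) :* T)) refl T x y ⟩
    x * (three * T)      ≡⟨ cong (x *_) (inverseʳ three three≢0) ⟩
    x * 1#               ≡⟨ *-identityʳ x ⟩
    x                    ∎
    where T = three ⁻¹

  interpolate-root : three ≢ 0# → ∀ x y {v} → 1# + v + v * v ≡ 0# → interpolate x y v ≡ y
  interpolate-root three≢0 x y {v} 1+v+v²≡0 = begin
    interpolate x y v                                     ≡⟨ solve 4 (λ T x y v →
        T :* (x :* (𝟙 :+ v :+ v :* v) :+ y :* ((𝟙 :+ 𝟙) :+ :- v :+ :- (v :* v)))
        := (T :* x :+ :- (T :* y)) :* (𝟙 :+ v :+ v :* v) :+ y :* ((𝟙 :+ 𝟙 :+ 𝟙) :* T)) refl T x y v ⟩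
    (T * x + - (T * y)) * (1# + v + v * v) + y * (three * T)
      ≡⟨ cong₂ (λ s t → (T * x + - (T * y)) * s + y * t) 1+v+v²≡0 (inverseʳ three three≢0) ⟩
    (T * x + - (T * y)) * 0# + y * 1#                     ≡⟨ solve 2 (λ a y → a :* 𝟘 :+ y :* 𝟙 := y) refl (T * x + - (T * y)) y ⟩
    y                                                     ∎
    where T = three ⁻¹

module Generator {F : Set} (𝔽 : IsField F) {N : ℕ} (1<N : 1 ℕ.< N) (E : Fin (suc N) ↔ F)
    (γ : F) (generates : ∀ x → x ≢ IsField.0# 𝔽 → ∃ λ i → IsField._^_ 𝔽 γ i ≡ x) where

  open IsField 𝔽
  open FieldProperties 𝔽
  open Inverse E using (to; from)
  open ≡-Reasoning

  instance
    N-nonZero : ℕ.NonZero N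
    N-nonZero = ℕ.>-nonZero (ℕ.<-trans ℕ.z<s 1<N)

  infix 4 _≟_
  _≟_ : DecidableEquality F
  _≟_ = Fin.inj⇒≟ (↔⇒↣ (↔-sym E))

  to-injective : ∀ {a b} → to a ≡ to b → a ≡ b
  to-injective = Injection.injective (↔⇒↣ E)

  from-injective : ∀ {x y} → from x ≡ from y → x ≡ y
  from-injective = Injection.injective (↔⇒↣ (↔-sym E))

  powers-cover⇒N≤d : ∀ d → (∀ x → x ≢ 0# → ∃ λ j → j ℕ.< d × γ ^ j ≡ x) → N ℕ.≤ d
  powers-cover⇒N≤d d cover = ℕ.s≤s⁻¹ (Fin.injective⇒≤ index∘to-injective)
    where
      index : F → Fin (suc d)
      index x with x ≟ 0#
      ... | yes _   = Fin.zero
      ... | no x≢0 = Fin.suc (fromℕ< (proj₁ (proj₂ (cover x x≢0))))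

      point : Fin (suc d) → F
      point Fin.zero    = 0#
      point (Fin.suc j) = γ ^ toℕ j

      point∘index : ∀ x → point (index x) ≡ x
      point∘index x with x ≟ 0#
      ... | yes x≡0 = sym x≡0
      ... | no x≢0 with j , j<d , γʲ≡x ← cover x x≢0 = trans (cong (γ ^_) (Fin.toℕ-fromℕ< j<d)) γʲ≡x

      index∘to-injective : ∀ {a b} → index (to a) ≡ index (to b) → a ≡ b
      index∘to-injective {a} {b} eq =
        to-injective (trans (sym (point∘index (to a))) (trans (cong point eq) (point∘index (to b))))

  γ≢0 : γ ≢ 0#
  γ≢0 γ≡0 = ℕ.<⇒≱ 1<N (powers-cover⇒N≤d 1 only-1)
    where
      only-1 : ∀ x → x ≢ 0# → ∃ λ j → j ℕ.< 1 × γ ^ j ≡ x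
      only-1 x x≢0 with generates x x≢0
      ... | zero  , 1≡x    = 0 , ℕ.z<s , 1≡x
      ... | suc i , γⁱ⁺¹≡x = ⊥-elim (x≢0 (trans (sym γⁱ⁺¹≡x) (trans (cong (_* γ ^ i) γ≡0) (zeroˡ _))))

  order-minimal : ∀ d → 0 ℕ.< d → γ ^ d ≡ 1# → N ℕ.≤ d
  order-minimal d@(suc _) _ γᵈ≡1 = powers-cover⇒N≤d d reduce
    where
      reduce : ∀ x → x ≢ 0# → ∃ λ j → j ℕ.< d × γ ^ j ≡ x
      reduce x x≢0 with i , γⁱ≡x ← generates x x≢0 = i ℕ.% d , m%n<n i d , trans (^-% γᵈ≡1 i) γⁱ≡x

  from0≢from-γ^ : ∀ (i : Fin (suc N)) → from 0# ≢ from (γ ^ toℕ i)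
  from0≢from-γ^ i eq = ^-≢0 γ≢0 (toℕ i) (sym (from-injective eq))

  ∃γ^d≡1 : ∃ λ d → 0 ℕ.< d × d ℕ.≤ N × γ ^ d ≡ 1#
  ∃γ^d≡1 with i , j , i<j , eq ← Fin.pigeonhole (ℕ.n<1+n N) (λ i → punchOut (from0≢from-γ^ i)) =
    toℕ j ℕ.∸ toℕ i ,
    ℕ.m<n⇒0<n∸m i<j ,
    ℕ.≤-trans (ℕ.m∸n≤m (toℕ j) (toℕ i)) (ℕ.s≤s⁻¹ (Fin.toℕ<n j)) ,
    ^-∸ γ≢0 (ℕ.<⇒≤ i<j) (from-injective (Fin.punchOut-injective (from0≢from-γ^ i) (from0≢from-γ^ j) eq))

  γ^N≡1 : γ ^ N ≡ 1#
  γ^N≡1 with d , 0<d , d≤N , γᵈ≡1 ← ∃γ^d≡1 =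
    subst (λ d → γ ^ d ≡ 1#) (ℕ.≤-antisym d≤N (order-minimal d 0<d γᵈ≡1)) γᵈ≡1

  x^N≡1 : ∀ x → x ≢ 0# → x ^ N ≡ 1#
  x^N≡1 x x≢0 with t , γᵗ≡x ← generates x x≢0 = begin
    x ^ N            ≡⟨ cong (_^ N) γᵗ≡x ⟨
    (γ ^ t) ^ N      ≡⟨ ^-assocʳ γ t N ⟩
    γ ^ (t ℕ.* N)    ≡⟨ cong (γ ^_) (ℕ.*-comm t N) ⟩
    γ ^ (N ℕ.* t)    ≡⟨ x^d≡1⇒x^[d*t]≡1 {γ} {N} γ^N≡1 t ⟩
    1#               ∎

  γ^r≡1⇒r≡0 : ∀ {r} → r ℕ.< N → γ ^ r ≡ 1# → r ≡ 0
  γ^r≡1⇒r≡0 {zero}  _   _    = refl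
  γ^r≡1⇒r≡0 {suc r} r<N γʳ≡1 = ⊥-elim (ℕ.<⇒≱ r<N (order-minimal (suc r) ℕ.z<s γʳ≡1))

  γ^s≡1⇒N∣s : ∀ s → γ ^ s ≡ 1# → N ∣ s
  γ^s≡1⇒N∣s s γˢ≡1 = m%n≡0⇒n∣m s N (γ^r≡1⇒r≡0 (m%n<n s N) (trans (^-% γ^N≡1 s) γˢ≡1))

  γ^-injective-≤ : ∀ {a b} → b ℕ.≤ a → a ℕ.< N → γ ^ b ≡ γ ^ a → a ≡ b
  γ^-injective-≤ {a} {b} b≤a a<N γᵇ≡γᵃ = ℕ.≤-antisym (ℕ.m∸n≡0⇒m≤n a∸b≡0) b≤a
    where a∸b≡0 = γ^r≡1⇒r≡0 (ℕ.≤-<-trans (ℕ.m∸n≤m a b) a<N) (^-∸ γ≢0 b≤a γᵇ≡γᵃ)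

  γ^-injective : ∀ {a b} → a ℕ.< N → b ℕ.< N → γ ^ a ≡ γ ^ b → a ≡ b
  γ^-injective {a} {b} a<N b<N γᵃ≡γᵇ with ℕ.≤-total b a
  ... | inj₁ b≤a = γ^-injective-≤ b≤a a<N (sym γᵃ≡γᵇ)
  ... | inj₂ a≤b = sym (γ^-injective-≤ a≤b b<N γᵃ≡γᵇ)

  log : (x : F) → x ≢ 0# → ℕ
  log x x≢0 = proj₁ (generates x x≢0) ℕ.% N

  log<N : ∀ x (x≢0 : x ≢ 0#) → log x x≢0 ℕ.< N
  log<N x x≢0 = m%n<n _ N

  γ^log : ∀ x (x≢0 : x ≢ 0#) → γ ^ log x x≢0 ≡ x
  γ^log x x≢0 = trans (^-% γ^N≡1 _) (proj₂ (generates x x≢0))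

module Involution {F : Set} (𝔽 : IsField F) (_≟_ : DecidableEquality F) (n k : ℕ) (γ : F)
    (three≢0 : IsField.three 𝔽 ≢ IsField.0# 𝔽) (γ≢0 : γ ≢ IsField.0# 𝔽)
    (x^3m≡1 : ∀ x → x ≢ IsField.0# 𝔽 → IsField._^_ 𝔽 x (3 ℕ.* suc (suc n)) ≡ IsField.1# 𝔽) where

  open IsField 𝔽
  open FieldProperties 𝔽
  open ≡-Reasoning

  m : ℕ
  m = suc (suc n)

  g : F → F
  g = gPoly 𝔽 m k γ

  ζ β : F
  ζ = γ ^ m
  β = γ ^ (3 ℕ.* k ℕ.+ 1)

  u : F → F
  u x = ζ * x ^ m

  ζ³≡1 : ζ * (ζ * ζ) ≡ 1#
  ζ³≡1 = trans (sym (x^[3m]≡x^m³ γ m)) (x^3m≡1 γ γ≢0)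

  u³≡1 : ∀ x → x ≢ 0# → u x * (u x * u x) ≡ 1#
  u³≡1 x x≢0 = begin
    u x * (u x * u x)                              ≡⟨ solve 2 (λ z w → (z :* w) :* ((z :* w) :* (z :* w))
                                                        := (z :* (z :* z)) :* (w :* (w :* w))) refl ζ (x ^ m) ⟩
    ζ * (ζ * ζ) * (x ^ m * (x ^ m * x ^ m))        ≡⟨ cong₂ _*_ ζ³≡1 (trans (sym (x^[3m]≡x^m³ x m)) (x^3m≡1 x x≢0)) ⟩
    1# * 1#                                        ≡⟨ *-identityˡ 1# ⟩
    1#                                             ∎

  β^m≡ζ : β ^ m ≡ ζ
  β^m≡ζ = begin
    β ^ m                                 ≡⟨ ^-assocʳ γ (3 ℕ.* k ℕ.+ 1) m ⟩
    γ ^ ((3 ℕ.* k ℕ.+ 1) ℕ.* m)           ≡⟨ cong (γ ^_) ([3k+1]*m≡3m*k+m k m) ⟩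
    γ ^ (3 ℕ.* m ℕ.* k ℕ.+ m)             ≡⟨ ^-homo-* γ (3 ℕ.* m ℕ.* k) m ⟩
    γ ^ (3 ℕ.* m ℕ.* k) * ζ               ≡⟨ cong (_* ζ) (x^d≡1⇒x^[d*t]≡1 {γ} {3 ℕ.* m} (x^3m≡1 γ γ≢0) k) ⟩
    1# * ζ                                ≡⟨ *-identityˡ ζ ⟩
    ζ                                     ∎

  x*y≡β⇒u[x]*u[y]≡1 : ∀ {x y} → x * y ≡ β → u x * u y ≡ 1#
  x*y≡β⇒u[x]*u[y]≡1 {x} {y} xy≡β = begin
    (ζ * x ^ m) * (ζ * y ^ m)       ≡⟨ solve 3 (λ z a b → (z :* a) :* (z :* b) := (z :* z) :* (a :* b)) refl ζ (x ^ m) (y ^ m) ⟩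
    (ζ * ζ) * (x ^ m * y ^ m)       ≡⟨ cong ((ζ * ζ) *_) (^-distrib-* x y m) ⟨
    (ζ * ζ) * ((x * y) ^ m)         ≡⟨ cong (λ v → (ζ * ζ) * v ^ m) xy≡β ⟩
    (ζ * ζ) * β ^ m                 ≡⟨ cong ((ζ * ζ) *_) β^m≡ζ ⟩
    (ζ * ζ) * ζ                     ≡⟨ solve 1 (λ z → (z :* z) :* z := z :* (z :* z)) refl ζ ⟩
    ζ * (ζ * ζ)                     ≡⟨ ζ³≡1 ⟩
    1#                              ∎

  -- Each monomial of g is rewritten, using x^(3m) = 1, in terms of x⁻¹, x and w = x^m; what remains is
  -- a ring identity.
  g-on-units : ∀ x → x ≢ 0# → g x ≡ interpolate x (β * x ⁻¹) (u x)
  g-on-units x x≢0 = collect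
    (trans (x^j≡x⁻¹*x^[1+j] x≢0 (3 ℕ.* m ℕ.∸ 1)) (trans (cong (x ⁻¹ *_) (x^3m≡1 x x≢0)) (*-identityʳ _)))
    (trans (^-homo-* x (2 ℕ.* m) 1) (cong (_* (x * 1#)) (x^[2m]≡x^m² x m)))
    (trans (x^j≡x⁻¹*x^[1+j] x≢0 (2 ℕ.* m ℕ.∸ 1)) (cong (x ⁻¹ *_) (x^[2m]≡x^m² x m)))
    (^-homo-* x m 1)
    (x^j≡x⁻¹*x^[1+j] x≢0 (suc n))
    (x^[2m]≡x^m² γ m)
    (trans (cong (γ ^_) (ℕ.+-assoc (2 ℕ.* m) (3 ℕ.* k) 1)) (trans (^-homo-* γ (2 ℕ.* m) _) (cong (_* β) (x^[2m]≡x^m² γ m))))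
    (trans (cong (γ ^_) (ℕ.+-assoc m (3 ℕ.* k) 1)) (^-homo-* γ m _))
    where
      w = x ^ m
      T = three ⁻¹
      collect : ∀ {p₁ p₂ p₃ p₄ p₅ c₂ c₃ c₅} →
        p₁ ≡ x ⁻¹ → p₂ ≡ (w * w) * (x * 1#) → p₃ ≡ x ⁻¹ * (w * w) → p₄ ≡ w * (x * 1#) → p₅ ≡ x ⁻¹ * w →
        c₂ ≡ ζ * ζ → c₃ ≡ (ζ * ζ) * β → c₅ ≡ ζ * β →
        ((1# + 1#) * β) * T * p₁ + (c₂ * T) * p₂ + (- c₃ * T) * p₃ + (ζ * T) * p₄ + (- c₅ * T) * p₅ + (1# * T) * x
          ≡ interpolate x (β * x ⁻¹) (ζ * w)
      collect refl refl refl refl refl refl refl refl = solve 6 (λ β T i ζ w x →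
          ((𝟙 :+ 𝟙) :* β) :* T :* i :+ ((ζ :* ζ) :* T) :* ((w :* w) :* (x :* 𝟙)) :+ (:- ((ζ :* ζ) :* β) :* T) :* (i :* (w :* w))
            :+ (ζ :* T) :* (w :* (x :* 𝟙)) :+ (:- (ζ :* β) :* T) :* (i :* w) :+ (𝟙 :* T) :* x
          := T :* (x :* (𝟙 :+ ζ :* w :+ (ζ :* w) :* (ζ :* w)) :+ (β :* i) :* ((𝟙 :+ 𝟙) :+ :- (ζ :* w) :+ :- ((ζ :* w) :* (ζ :* w)))))
        refl β T (x ⁻¹) ζ w x

  u≡1⇒g≡id : ∀ x → x ≢ 0# → u x ≡ 1# → g x ≡ x
  u≡1⇒g≡id x x≢0 u≡1 = trans (g-on-units x x≢0) (trans (cong (interpolate x _) u≡1) (interpolate-1 three≢0 x _))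

  u≢1⇒g≡β/x : ∀ x → x ≢ 0# → u x ≢ 1# → g x ≡ β * x ⁻¹
  u≢1⇒g≡β/x x x≢0 u≢1 = trans (g-on-units x x≢0) (interpolate-root three≢0 x _ (x³≡1∧x≢1⇒1+x+x²≡0 (u³≡1 x x≢0) u≢1))

  g-0 : g 0# ≡ 0#
  g-0 = vanish _ _ _ _ _ _ _ _ _ _ _
    where
      vanish : ∀ a b c d e f p₁ p₂ p₃ p₄ p₅ →
        a * (0# * p₁) + b * (0# * p₂) + c * (0# * p₃) + d * (0# * p₄) + e * (0# * p₅) + f * 0# ≡ 0#
      vanish = solve 11 (λ a b c d e f p₁ p₂ p₃ p₄ p₅ →
        a :* (𝟘 :* p₁) :+ b :* (𝟘 :* p₂) :+ c :* (𝟘 :* p₃) :+ d :* (𝟘 :* p₄) :+ e :* (𝟘 :* p₅) :+ f :* 𝟘 := 𝟘) refl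

  β≢0 : β ≢ 0#
  β≢0 = ^-≢0 γ≢0 (3 ℕ.* k ℕ.+ 1)

  β/[β/x]≡x : ∀ {x} → x ≢ 0# → β * (β * x ⁻¹) ⁻¹ ≡ x
  β/[β/x]≡x {x} x≢0 = begin
    β * y ⁻¹             ≡⟨ cong (_* y ⁻¹) β≡y*x ⟩
    (y * x) * y ⁻¹       ≡⟨ solve 3 (λ a b c → (a :* b) :* c := b :* (a :* c)) refl y x (y ⁻¹) ⟩
    x * (y * y ⁻¹)       ≡⟨ cong (x *_) (inverseʳ y (*-≢0 β≢0 (⁻¹-≢0 x≢0))) ⟩
    x * 1#               ≡⟨ *-identityʳ x ⟩
    x                    ∎
    where
      y = β * x ⁻¹
      β≡y*x : β ≡ y * x
      β≡y*x = sym (x*y⁻¹*y≡x x≢0)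

  g-involutive : ∀ x → g (g x) ≡ x
  g-involutive x with x ≟ 0#
  ... | yes refl = trans (cong g g-0) g-0
  ... | no x≢0 with u x ≟ 1#
  ...   | yes u≡1 = trans (cong g (u≡1⇒g≡id x x≢0 u≡1)) (u≡1⇒g≡id x x≢0 u≡1)
  ...   | no u≢1 = begin
    g (g x)         ≡⟨ cong g (u≢1⇒g≡β/x x x≢0 u≢1) ⟩
    g y             ≡⟨ u≢1⇒g≡β/x y y≢0 u[y]≢1 ⟩
    β * y ⁻¹        ≡⟨ β/[β/x]≡x x≢0 ⟩
    x               ∎
    where
      y = β * x ⁻¹
      y≢0 = *-≢0 β≢0 (⁻¹-≢0 x≢0)
      u[y]≢1 : u y ≢ 1#
      u[y]≢1 u[y]≡1 = u≢1 (begin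
        u x             ≡⟨ *-identityˡ (u x) ⟨
        1# * u x        ≡⟨ cong (_* u x) u[y]≡1 ⟨
        u y * u x       ≡⟨ x*y≡β⇒u[x]*u[y]≡1 (x*y⁻¹*y≡x x≢0) ⟩
        1#              ∎)

  fixed⇒u≡1 : ∀ x → x ≢ 0# → g x ≡ x → u x ≡ 1#
  fixed⇒u≡1 x x≢0 gx≡x with u x ≟ 1#
  ... | yes u≡1 = u≡1
  ... | no u≢1 = begin
    u x                  ≡⟨ *-identityʳ (u x) ⟨
    u x * 1#             ≡⟨ cong (u x *_) (x*y≡β⇒u[x]*u[y]≡1 x*x≡β) ⟨
    u x * (u x * u x)    ≡⟨ u³≡1 x x≢0 ⟩
    1#                   ∎
    where
      x*x≡β : x * x ≡ β
      x*x≡β = begin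
        x * x                ≡⟨ cong (_* x) (trans (sym gx≡x) (u≢1⇒g≡β/x x x≢0 u≢1)) ⟩
        (β * x ⁻¹) * x       ≡⟨ x*y⁻¹*y≡x x≢0 ⟩
        β                    ∎

  u[γ^t]≡γ^[[1+t]*m] : ∀ t → u (γ ^ t) ≡ γ ^ (suc t ℕ.* m)
  u[γ^t]≡γ^[[1+t]*m] t = trans (cong (ζ *_) (^-assocʳ γ t m)) (sym (^-homo-* γ m (t ℕ.* m)))

IsInvolutionWithFixedPoints : {F : Set} → (F → F) → ℕ → Set
IsInvolutionWithFixedPoints {F} f c = Bijective _≡_ _≡_ f × (∀ x → f (f x) ≡ x) × ((Σ F λ x → f x ≡ x) ↔ Fin c)

module FixedPoints {F : Set} (𝔽 : IsField F) (n k : ℕ) (E : Fin (suc (3 ℕ.* suc (suc n))) ↔ F) (γ : F)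
    (generates : ∀ x → x ≢ IsField.0# 𝔽 → ∃ λ i → IsField._^_ 𝔽 γ i ≡ x) where

  open IsField 𝔽
  open FieldProperties 𝔽
  open ≡-Reasoning

  m : ℕ
  m = suc (suc n)

  open Generator 𝔽 {3 ℕ.* m} (ℕ.s≤s (ℕ.s≤s ℕ.z≤n)) E γ generates

  γ^m≢1 : γ ^ m ≢ 1#
  γ^m≢1 γᵐ≡1 = ℕ.<⇒≱ (ℕ.m<m+n m ℕ.z<s) (order-minimal m ℕ.z<s γᵐ≡1)

  three≢0 : three ≢ 0#
  three≢0 = 1+x+x²≡0∧x≢1⇒three≢0 (x³≡1∧x≢1⇒1+x+x²≡0 γ^m³≡1 γ^m≢1) γ^m≢1
    where γ^m³≡1 = trans (sym (x^[3m]≡x^m³ γ m)) γ^N≡1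

  open Involution 𝔽 _≟_ n k γ three≢0 γ≢0 x^N≡1 hiding (m)

  fixedPoint : Fin (suc m) → F
  fixedPoint Fin.zero    = 0#
  fixedPoint (Fin.suc j) = γ ^ (3 ℕ.* toℕ j ℕ.+ 2)

  fixedPoint-fixed : ∀ j → g (fixedPoint j) ≡ fixedPoint j
  fixedPoint-fixed Fin.zero    = g-0
  fixedPoint-fixed (Fin.suc j) = u≡1⇒g≡id (γ ^ e) (^-≢0 γ≢0 e) (begin
    u (γ ^ e)                               ≡⟨ u[γ^t]≡γ^[[1+t]*m] e ⟩
    γ ^ (suc (3 ℕ.* toℕ j ℕ.+ 2) ℕ.* m)     ≡⟨ cong (γ ^_) ([1+[3j+2]]*m≡3m*[1+j] (toℕ j) m) ⟩
    γ ^ (3 ℕ.* m ℕ.* suc (toℕ j))           ≡⟨ x^d≡1⇒x^[d*t]≡1 {γ} {3 ℕ.* m} γ^N≡1 (suc (toℕ j)) ⟩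
    1#                                      ∎)
    where e = 3 ℕ.* toℕ j ℕ.+ 2

  3∣1+log : ∀ x (x≢0 : x ≢ 0#) → g x ≡ x → 3 ∣ suc (log x x≢0)
  3∣1+log x x≢0 gx≡x = *-cancelʳ-∣ m (γ^s≡1⇒N∣s _ (begin
    γ ^ (suc t ℕ.* m)   ≡⟨ u[γ^t]≡γ^[[1+t]*m] t ⟨
    u (γ ^ t)           ≡⟨ cong u (γ^log x x≢0) ⟩
    u x                 ≡⟨ fixed⇒u≡1 x x≢0 gx≡x ⟩
    1#                  ∎))
    where t = log x x≢0

  fixedIndex : ∀ x → g x ≡ x → Fin (suc m)
  fixedIndex x gx≡x with x ≟ 0#
  ... | yes _   = Fin.zero
  ... | no x≢0 = Fin.suc (proj₁ (exponent-form (log<N x x≢0) (3∣1+log x x≢0 gx≡x)))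

  fixedPoint∘fixedIndex : ∀ x (gx≡x : g x ≡ x) → fixedPoint (fixedIndex x gx≡x) ≡ x
  fixedPoint∘fixedIndex x gx≡x with x ≟ 0#
  ... | yes x≡0 = sym x≡0
  ... | no x≢0 = trans (cong (γ ^_) (sym (proj₂ (exponent-form (log<N x x≢0) (3∣1+log x x≢0 gx≡x))))) (γ^log x x≢0)

  fixedIndex∘fixedPoint : ∀ j (fixed : g (fixedPoint j) ≡ fixedPoint j) → fixedIndex (fixedPoint j) fixed ≡ j
  fixedIndex∘fixedPoint Fin.zero _ with 0# ≟ 0#
  ... | yes _   = refl
  ... | no 0≢0 = ⊥-elim (0≢0 refl)
  fixedIndex∘fixedPoint (Fin.suc j) fixed with γ ^ (3 ℕ.* toℕ j ℕ.+ 2) ≟ 0#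
  ... | yes γᵉ≡0 = ⊥-elim (^-≢0 γ≢0 (3 ℕ.* toℕ j ℕ.+ 2) γᵉ≡0)
  ... | no γᵉ≢0 = cong Fin.suc (Fin.toℕ-injective (3i+2-injective (trans (sym t≡3i+2) t≡3j+2)))
    where
      t≡3i+2 = proj₂ (exponent-form (log<N _ γᵉ≢0) (3∣1+log _ γᵉ≢0 fixed))
      t≡3j+2 = γ^-injective (log<N _ γᵉ≢0) (j<m⇒3j+2<3m (Fin.toℕ<n j)) (γ^log _ γᵉ≢0)

  fixed-≡ : ∀ {x y} {p : g x ≡ x} {q : g y ≡ y} → x ≡ y → _≡_ {A = Σ F λ x → g x ≡ x} (x , p) (y , q)
  fixed-≡ refl = cong (_ ,_) (Decidable⇒UIP.≡-irrelevant _≟_ _ _)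

  fixedPoints↔Fin[1+m] : (Σ F λ x → g x ≡ x) ↔ Fin (suc m)
  fixedPoints↔Fin[1+m] = mk↔ₛ′
    (λ (x , gx≡x) → fixedIndex x gx≡x)
    (λ j → fixedPoint j , fixedPoint-fixed j)
    (λ j → fixedIndex∘fixedPoint j (fixedPoint-fixed j))
    (λ (x , gx≡x) → fixed-≡ (fixedPoint∘fixedIndex x gx≡x))

  g-isInvolutionWithFixedPoints : IsInvolutionWithFixedPoints g (m ℕ.+ 1)
  g-isInvolutionWithFixedPoints =
    Bijection.bijective (↔⇒⤖ (mk↔ₛ′ g g g-involutive g-involutive)) ,
    g-involutive ,
    subst (λ c → (Σ F λ x → g x ≡ x) ↔ Fin c) (ℕ.+-comm 1 m) fixedPoints↔Fin[1+m]

-- The oddness of q only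
-- excludes q = 4: for m = 1 the monomial x^(m-1) of g is constant and g(0) ≠ 0.
involution-theorem : ∀ m q → q ≡ suc (3 ℕ.* m) → q ℕ.% 2 ≡ 1 →
  {F : Set} (𝔽 : IsField F) → Fin q ↔ F →
  (γ : F) → (∀ x → x ≢ IsField.0# 𝔽 → ∃ λ i → IsField._^_ 𝔽 γ i ≡ x) →
  (k : ℕ) → k ℕ.< m → IsInvolutionWithFixedPoints (gPoly 𝔽 m k γ) (m ℕ.+ 1)
involution-theorem zero          _ _    _  _ _ _ _ _ ()
involution-theorem (suc zero)    _ refl () _ _ _ _ _ _
involution-theorem (suc (suc n)) _ refl _  𝔽 E γ generates k _ =
  FixedPoints.g-isInvolutionWithFixedPoints 𝔽 n k E γ generates

-- Opened only now: they would clash with the field operations opened in the modules above.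
open import Data.Nat using (_+_; _*_; _∸_; _^_; _/_; _%_; _<_; _≥_)
open import Data.Nat.Primality using (Prime)
open import Relation.Nullary using (¬_)

theorem2p6 : (q p n : ℕ) → Prime p → n ≥ 1 → q ≡ p ^ n → q % 2 ≡ 1 → q % 3 ≡ 1 →
    {F : Set} (𝔽 : IsField F) → (Fin q ↔ F) →
    (γ : F) → (∀ x → ¬ (x ≡ IsField.0# 𝔽) → ∃ λ i → IsField._^_ 𝔽 γ i ≡ x) →
    (k : ℕ) → k < (q ∸ 1) / 3 →
    Bijective _≡_ _≡_ (gPoly 𝔽 ((q ∸ 1) / 3) k γ)
    × (∀ x → gPoly 𝔽 ((q ∸ 1) / 3) k γ (gPoly 𝔽 ((q ∸ 1) / 3) k γ x) ≡ x)
    × ((Σ F λ x → gPoly 𝔽 ((q ∸ 1) / 3) k γ x ≡ x) ↔ Fin ((q ∸ 1) / 3 + 1))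
theorem2p6 q _ _ _ _ _ q-odd q≡1[3] 𝔽 E γ generates k k<m =
  involution-theorem ((q ∸ 1) / 3) q (q≡1+3[[q-1]/3] q q≡1[3]) q-odd 𝔽 E γ generates k k<m
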